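{- Let $n,h\ge2$ and $p\in\mathcal{P}$, and assume that both $\Gamma_{\mu(p)}(p)$ and $\Gamma_{\mu(p^r)}(p^r)$ admit an acyclic connected component. Then: (i) $\mu(p)=\mu(p^r)$; (ii) if $\Gamma_{\mu(p)}(p)$ is connected, then $D_{\mu(p)}(p)\cap D_{\mu(p^r)}(p^r)=\varnothing$; (iii) if $\Gamma_{\mu(p)}(p)$ is acyclic, then there is no $x\in N$ such that $D_{\mu(p)}(p)=D_{\mu(p^r)}(p^r)=\{x\}$.
   Context: $N=\{1,\dots,n\}$, $H=\{1,\dots,h\}$, $\mathcal{P}=\mathcal{L}(N)^h$ the set of profiles of linear orders on $N$; $x>_{p_i}y$ means individual $i$ ranks $x$ above $y$; $p^r$ reverses each individual's order. For integers $\mu$ with $h/2<\mu\le h$: $D_\mu(p)=\{x\in N:\forall y,\ |\{i: y>_{p_i}x\}|<\mu\}$; $\mu(p)=\min\{\mu: D_\mu(p)\ne\varnothing\}$; $\Gamma_\mu(p)$ is the directed graph on $N$ with arcs $(x,y)$ whenever $|\{i:x>_{p_i}y\}|\ge\mu$. Connected components are those of the underlying undirected graph; a graph is acyclic if no subgraph is an $l$-cycle ($l\ge2$ vertices $x_1,\dots,x_l$ with arcs exactly $(x_j,x_{j+1})$, $x_{l+1}=x_1$). -}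

module Defs where

open import Data.Nat using (ℕ; zero; suc; _<_; _≤_; _*_)
open import Data.Fin using (Fin; zero; suc; inject₁; fromℕ)
import Data.Fin.Properties as FinP
open import Data.Fin.Permutation using (Permutation′; _⟨$⟩ʳ_; _∘ₚ_; reverse)
open import Data.List using (List; length; filter; allFin)
open import Data.Product using (Σ; ∃; _×_; _,_)
open import Data.Sum using (_⊎_)
open import Relation.Nullary using (¬_)
open import Relation.Binary.PropositionalEquality using (_≡_)
open import Relation.Binary.Construct.Closure.ReflexiveTransitive using (Star)
open import Function.Definitions using (Injective)
open import Function.Bundles using (_⇔_)

-- Alternatives N = Fin n, individuals H = Fin h.
-- A linear order on Fin n is given by a ranking permutation:
-- (π ⟨$⟩ʳ x) is the position of x, position zero being the top.
LinOrd : ℕ → Set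
LinOrd n = Permutation′ n

Profile : ℕ → ℕ → Set
Profile n h = Fin h → LinOrd n

Prefers : ∀ {n h} → Profile n h → Fin h → Fin n → Fin n → Set
Prefers p i x y = (p i ⟨$⟩ʳ x) Data.Fin.< (p i ⟨$⟩ʳ y)

rev : ∀ {n h} → Profile n h → Profile n h
rev p i = p i ∘ₚ reverse

support : ∀ {n h} → Profile n h → Fin n → Fin n → ℕ
support {h = h} p x y =
  length (filter (λ i → (p i ⟨$⟩ʳ x) FinP.<? (p i ⟨$⟩ʳ y)) (allFin h))

Admissible : ℕ → ℕ → Set
Admissible h μ = (h < 2 * μ) × (μ ≤ h)

InD : ∀ {n h} → ℕ → Profile n h → Fin n → Set
InD μ p x = ∀ y → support p y x < μ

IsMuOf : ∀ {n h} → Profile n h → ℕ → Set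
IsMuOf {h = h} p m =
  Admissible h m × (∃ λ x → InD m p x) ×
  (∀ μ → Admissible h μ → μ < m → ∀ x → ¬ InD μ p x)

Arc : ∀ {n h} → ℕ → Profile n h → Fin n → Fin n → Set
Arc μ p x y = μ ≤ support p x y

module _ {n : ℕ} (A : Fin n → Fin n → Set) where

  UEdge : Fin n → Fin n → Set
  UEdge x y = A x y ⊎ A y x

  SameComponent : Fin n → Fin n → Set
  SameComponent = Star UEdge

  Connected : Set
  Connected = ∀ x y → SameComponent x y

  record Cycle : Set where
    field
      k     : ℕ
      f     : Fin (suc (suc k)) → Fin n
      inj   : Injective _≡_ _≡_ f
      step  : ∀ (j : Fin (suc k)) → A (f (inject₁ j)) (f (suc j))
      close : A (f (fromℕ (suc k))) (f zero)

  Acyclic : Set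
  Acyclic = ¬ Cycle

  AcyclicComponentOf : Fin n → Set
  AcyclicComponentOf v =
    ¬ (Σ Cycle λ c → ∀ j → SameComponent v (Cycle.f c j))

  HasAcyclicComponent : Set
  HasAcyclicComponent = ∃ λ v → AcyclicComponentOf v

DIsSingleton : ∀ {n h} → ℕ → Profile n h → Fin n → Set
DIsSingleton μ p x = ∀ y → (InD μ p y ⇔ (y ≡ x))

-- Since Γ_μ(p^r) is the converse of Γ_μ(p), D_μ(p) is the set of sources of
-- Γ_μ(p) and D_μ(p^r) its set of sinks. Following predecessors from a vertex
-- of a finite digraph either ends at a source or runs into a cycle, so a
-- digraph with an acyclic component has a source and, applied to the converse,
-- a sink. Hence D_m(p^r) and D_m′(p) are non-empty and minimality gives
-- m′ ≤ m ≤ m′. A point x of D_m(p) ∩ D_m(p^r) is then isolated in Γ_m(p),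
-- impossible when it is connected and n ≥ 2. If Γ_m(p) is acyclic, any y ≠ x
-- is reached from a source, which must be x, while x, being a sink, reaches
-- only itself.

module Submission where

open import Defs
open import Data.Nat using (ℕ; _≤_)
open import Data.Fin using (Fin)
open import Data.Product using (∃; _×_)
open import Relation.Nullary using (¬_)
open import Relation.Binary.PropositionalEquality using (_≡_)

open import Data.Nat as ℕ using (zero; suc; _+_; z≤n; s≤s; _≤?_)
import Data.Nat.Properties as ℕ
open import Data.Fin as Fin using (zero; suc; toℕ; inject₁; inject≤; fromℕ; opposite; punchIn; _≟_)
import Data.Fin.Properties as Fin
open import Data.Fin.Permutation using (reverse)
open import Data.List using (length; allFin)
open import Data.List.Properties using (filter-≐; filter-none)
open import Data.List.Relation.Unary.All using (universal)
open import Data.Product using (Σ; _,_; proj₁)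
open import Data.Sum using (_⊎_; inj₁; inj₂)
open import Function using (_∘_)
open import Function.Bundles using (Equivalence; Injection)
open import Function.Definitions using (Injective)
open import Function.Properties.Inverse using (↔⇒↣)
open import Level using (0ℓ)
open import Relation.Binary using (Rel; Decidable; Irreflexive)
open import Relation.Binary.PropositionalEquality
  using (_≢_; refl; sym; trans; cong; subst; subst₂; module ≡-Reasoning)
open import Relation.Binary.Construct.Closure.ReflexiveTransitive as Star
  using (Star; ε; _◅_)
open import Relation.Nullary using (yes; no; contradiction)

Source Sink : ∀ {n} → Rel (Fin n) 0ℓ → Fin n → Set
Source A x = ∀ y → ¬ A y x
Sink   A x = ∀ y → ¬ A x y

Sink-Star⇒≡ : ∀ {n} {R : Rel (Fin n) 0ℓ} {x y} → Sink R x → Star R x y → x ≡ y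
Sink-Star⇒≡ sink ε       = refl
Sink-Star⇒≡ sink (r ◅ _) = contradiction r (sink _)

opposite-inject₁ : ∀ {n} (i : Fin n) → opposite (inject₁ i) ≡ suc (opposite i)
opposite-inject₁ {suc _} zero    = refl
opposite-inject₁ {suc _} (suc i) = cong inject₁ (opposite-inject₁ i)

opposite-<⁺ : ∀ {n} {i j : Fin n} → i Fin.< j → opposite j Fin.< opposite i
opposite-<⁺ {i = i} {j} i<j rewrite Fin.opposite-prop i | Fin.opposite-prop j =
  ℕ.∸-monoʳ-< (s≤s i<j) (Fin.toℕ<n j)

opposite-<⁻ : ∀ {n} {i j : Fin n} → opposite j Fin.< opposite i → i Fin.< j
opposite-<⁻ {i = i} {j} lt =
  subst₂ Fin._<_ (Fin.opposite-involutive i) (Fin.opposite-involutive j) (opposite-<⁺ lt)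

module _ {n : ℕ} {A B : Rel (Fin n) 0ℓ} (converse : ∀ {x y} → B x y → A y x) where

  reverseCycle : Cycle B → Cycle A
  reverseCycle c = record
    { k     = k
    ; f     = f ∘ opposite
    ; inj   = Injection.injective (↔⇒↣ reverse) ∘ inj
    ; step  = step′
    ; close = subst (λ i → A (f i) (f (fromℕ (suc k))))
                    (sym (Fin.opposite-involutive zero)) (converse close)
    }
    where
    open Cycle c
    step′ : ∀ j → A (f (opposite (inject₁ j))) (f (opposite (suc j)))
    step′ j rewrite opposite-inject₁ j = converse (step (opposite j))

  AcyclicComponentOf-converse : ∀ {v} → AcyclicComponentOf A v → AcyclicComponentOf B v
  AcyclicComponentOf-converse acyclic (c , inComponent) =
    acyclic (reverseCycle c , Star.map edge ∘ inComponent ∘ opposite)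
    where
    edge : ∀ {x y} → UEdge B x y → UEdge A x y
    edge (inj₁ b) = inj₂ (converse b)
    edge (inj₂ b) = inj₁ (converse b)

  HasAcyclicComponent-converse : HasAcyclicComponent A → HasAcyclicComponent B
  HasAcyclicComponent-converse (v , acyclic) = v , AcyclicComponentOf-converse acyclic

record SimplePathTo {n} (A : Rel (Fin n) 0ℓ) (v : Fin n) : Set where
  field
    len       : ℕ
    vertex    : Fin (suc len) → Fin n
    injective : Injective _≡_ _≡_ vertex
    arc       : ∀ j → A (vertex (inject₁ j)) (vertex (suc j))
    reaches   : ∀ j → Star A (vertex j) v

SourceReaching CycleReaching : ∀ {n} → Rel (Fin n) 0ℓ → Fin n → Set
SourceReaching A v = ∃ λ w → Source A w × Star A w v
CycleReaching A v = Σ (Cycle A) λ c → ∀ j → Star A (Cycle.f c j) v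

module _ {n : ℕ} {A : Rel (Fin n) 0ℓ} {v : Fin n} where
  open SimplePathTo

  trivialPath : SimplePathTo A v
  trivialPath = record
    { len = 0 ; vertex = λ _ → v ; injective = λ { {zero} {zero} _ → refl }
    ; arc = λ () ; reaches = λ _ → ε }

  prepend : (P : SimplePathTo A v) {z : Fin n} → A z (vertex P zero) →
            (∀ j → vertex P j ≢ z) → SimplePathTo A v
  prepend P {z} z→head fresh = record
    { len = suc (len P) ; vertex = vertex′ ; injective = injective′
    ; arc = arc′ ; reaches = reaches′ }
    where
    vertex′ : Fin (suc (suc (len P))) → Fin n
    vertex′ zero    = z
    vertex′ (suc j) = vertex P j
    injective′ : Injective _≡_ _≡_ vertex′
    injective′ {zero}  {zero}  _  = refl
    injective′ {zero}  {suc j} eq = contradiction (sym eq) (fresh j)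
    injective′ {suc i} {zero}  eq = contradiction eq (fresh i)
    injective′ {suc i} {suc j} eq = cong suc (injective P eq)
    arc′ : ∀ j → A (vertex′ (inject₁ j)) (vertex′ (suc j))
    arc′ zero    = z→head
    arc′ (suc j) = arc P j
    reaches′ : ∀ j → Star A (vertex′ j) v
    reaches′ zero    = z→head ◅ reaches P zero
    reaches′ (suc j) = reaches P j

  closeCycle : (P : SimplePathTo A v) (i : Fin (len P)) →
               A (vertex P (suc i)) (vertex P zero) → CycleReaching A v
  closeCycle P i back = cycle , reaches P ∘ prefix
    where
    prefix≤ : suc (suc (toℕ i)) ≤ suc (len P)
    prefix≤ = s≤s (Fin.toℕ<n i)
    prefix : Fin (suc (suc (toℕ i))) → Fin (suc (len P))
    prefix j = inject≤ j prefix≤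
    prefix-inject₁ : ∀ j → prefix (inject₁ j) ≡ inject₁ (inject≤ j (Fin.toℕ<n i))
    prefix-inject₁ j = Fin.toℕ-injective (begin
      toℕ (prefix (inject₁ j))                ≡⟨ Fin.toℕ-inject≤ (inject₁ j) prefix≤ ⟩
      toℕ (inject₁ j)                         ≡⟨ Fin.toℕ-inject₁ j ⟩
      toℕ j                                   ≡⟨ Fin.toℕ-inject≤ j _ ⟨
      toℕ (inject≤ j (Fin.toℕ<n i))           ≡⟨ Fin.toℕ-inject₁ _ ⟨
      toℕ (inject₁ (inject≤ j (Fin.toℕ<n i))) ∎)
      where open ≡-Reasoning
    prefix-last : prefix (fromℕ (suc (toℕ i))) ≡ suc i
    prefix-last = Fin.toℕ-injective (trans (Fin.toℕ-inject≤ _ prefix≤) (Fin.toℕ-fromℕ _))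
    step : ∀ j → A (vertex P (prefix (inject₁ j))) (vertex P (prefix (suc j)))
    step j rewrite prefix-inject₁ j = arc P (inject≤ j (Fin.toℕ<n i))
    cycle : Cycle A
    cycle = record
      { k = toℕ i ; f = vertex P ∘ prefix
      ; inj = Fin.inject≤-injective prefix≤ prefix≤ _ _ ∘ injective P
      ; step = step
      ; close = subst (λ j → A (vertex P j) (vertex P zero)) (sym prefix-last) back }

module _ {n : ℕ} {A : Rel (Fin n) 0ℓ} (A? : Decidable A) (irreflexive : Irreflexive _≡_ A) where
  open SimplePathTo

  mutual
    search : ∀ {v} fuel (P : SimplePathTo A v) → n ≤ suc (len P) + fuel →
             SourceReaching A v ⊎ CycleReaching A v
    search fuel P bound with Fin.any? (λ z → A? z (vertex P zero))
    ... | no noPredecessor =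
      inj₁ (vertex P zero , (λ z a → noPredecessor (z , a)) , reaches P zero)
    ... | yes (z , z→head) with Fin.any? (λ j → vertex P j ≟ z)
    ...   | no fresh = grow fuel P bound z→head (λ j eq → fresh (j , eq))
    ...   | yes (zero  , refl) = contradiction z→head (irreflexive refl)
    ...   | yes (suc i , refl) = inj₂ (closeCycle P i z→head)

    grow : ∀ {v} fuel (P : SimplePathTo A v) → n ≤ suc (len P) + fuel →
           ∀ {z} → A z (vertex P zero) → (∀ j → vertex P j ≢ z) →
           SourceReaching A v ⊎ CycleReaching A v
    -- Without fuel the path already has n vertices, so no predecessor is fresh.
    grow zero P bound z→head fresh =
      contradiction (ℕ.≤-trans (Fin.injective⇒≤ (injective (prepend P z→head fresh)))
                               (subst (n ≤_) (ℕ.+-identityʳ _) bound))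
                    (ℕ.n≮n _)
    grow (suc fuel) P bound z→head fresh =
      search fuel (prepend P z→head fresh) (subst (n ≤_) (ℕ.+-suc _ fuel) bound)

  source-or-cycle : ∀ v → SourceReaching A v ⊎ CycleReaching A v
  source-or-cycle v = search n trivialPath (ℕ.n≤1+n n)

  HasAcyclicComponent⇒Source : HasAcyclicComponent A → ∃ (Source A)
  HasAcyclicComponent⇒Source (v , acyclic) with source-or-cycle v
  ... | inj₁ (w , source , _) = w , source
  ... | inj₂ (c , reach)      = contradiction (c , Star.reverse inj₂ ∘ reach) acyclic

  Acyclic⇒SourceReaching : Acyclic A → ∀ v → SourceReaching A v
  Acyclic⇒SourceReaching acyclic v with source-or-cycle v
  ... | inj₁ reached = reached
  ... | inj₂ (c , _) = contradiction c acyclic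

module _ {n h : ℕ} (p : Profile n h) where

  support-rev : ∀ x y → support (rev p) x y ≡ support p y x
  support-rev x y = cong length (filter-≐ _ _ (opposite-<⁻ , opposite-<⁺) (allFin h))

  support-refl : ∀ x → support p x x ≡ 0
  support-refl x = cong length (filter-none _ (universal (λ _ → ℕ.n≮n _) (allFin h)))

  module _ {μ : ℕ} where

    Arc-rev⁺ : ∀ {x y} → Arc μ p x y → Arc μ (rev p) y x
    Arc-rev⁺ {x} {y} = subst (μ ≤_) (sym (support-rev y x))

    Arc-rev⁻ : ∀ {x y} → Arc μ (rev p) x y → Arc μ p y x
    Arc-rev⁻ {x} {y} = subst (μ ≤_) (support-rev x y)

    Arc-irreflexive : 1 ≤ μ → Irreflexive _≡_ (Arc μ p)
    Arc-irreflexive 1≤μ {x} refl arc =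
      ℕ.n≮n 0 (ℕ.≤-trans 1≤μ (subst (μ ≤_) (support-refl x) arc))

    Arc-decidable : Decidable (Arc μ p)
    Arc-decidable x y = μ ≤? support p x y

    InD⇒Source : ∀ {x} → InD μ p x → Source (Arc μ p) x
    InD⇒Source inD y = ℕ.<⇒≱ (inD y)

    Source⇒InD : ∀ {x} → Source (Arc μ p) x → InD μ p x
    Source⇒InD source y = ℕ.≰⇒> (source y)

module _ {n h : ℕ} (p : Profile n h) {μ : ℕ} where

  InD-rev⇒Sink : ∀ {x} → InD μ (rev p) x → Sink (Arc μ p) x
  InD-rev⇒Sink inD y = InD⇒Source (rev p) inD y ∘ Arc-rev⁺ p

  HasAcyclicComponent⇒InD : 1 ≤ μ → HasAcyclicComponent (Arc μ p) → ∃ (InD μ p)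
  HasAcyclicComponent⇒InD 1≤μ acyclic
    with HasAcyclicComponent⇒Source (Arc-decidable p) (Arc-irreflexive p 1≤μ) acyclic
  ... | x , source = x , Source⇒InD p source

  Connected⇒InD-disjoint : 2 ≤ n → Connected (Arc μ p) →
                           ∀ x → ¬ (InD μ p x × InD μ (rev p) x)
  Connected⇒InD-disjoint (s≤s (s≤s _)) connected x (inD , inDʳ) =
    Fin.punchInᵢ≢i x zero (sym (Sink-Star⇒≡ isolated (connected x (punchIn x zero))))
    where
    isolated : Sink (UEdge (Arc μ p)) x
    isolated y (inj₁ x→y) = InD-rev⇒Sink inDʳ y x→y
    isolated y (inj₂ y→x) = InD⇒Source p inD y y→x

  Acyclic⇒¬InD-singletons : 2 ≤ n → 1 ≤ μ → Acyclic (Arc μ p) →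
    ¬ (∃ λ x → DIsSingleton μ p x × DIsSingleton μ (rev p) x)
  Acyclic⇒¬InD-singletons (s≤s (s≤s _)) 1≤μ acyclic (x , D≡x , Dʳ≡x)
    with Acyclic⇒SourceReaching (Arc-decidable p) (Arc-irreflexive p 1≤μ) acyclic
                                (punchIn x zero)
  ... | w , source , w⇝y with Equivalence.to (D≡x w) (Source⇒InD p source)
  ... | refl = Fin.punchInᵢ≢i w zero (sym (Sink-Star⇒≡ sink w⇝y))
    where
    sink : Sink (Arc μ p) w
    sink = InD-rev⇒Sink (Equivalence.from (Dʳ≡x w) refl)

Admissible⇒1≤ : ∀ {h μ} → Admissible h μ → 1 ≤ μ
Admissible⇒1≤ {μ = zero}  (h<0 , _) = contradiction h<0 ℕ.n≮0
Admissible⇒1≤ {μ = suc _} _         = s≤s z≤n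

IsMuOf-minimal : ∀ {n h} (p : Profile n h) {m μ} → IsMuOf p m → Admissible h μ →
                 HasAcyclicComponent (Arc μ p) → m ≤ μ
IsMuOf-minimal p (_ , _ , minimal) admissible acyclic
  with HasAcyclicComponent⇒InD p (Admissible⇒1≤ admissible) acyclic
... | x , inD = ℕ.≮⇒≥ λ μ<m → minimal _ admissible μ<m x inD

lemma18 : ∀ {n h : ℕ} → 2 ≤ n → 2 ≤ h → (p : Profile n h) → (m m′ : ℕ) →
    IsMuOf p m → IsMuOf (rev p) m′ →
    HasAcyclicComponent (Arc m p) → HasAcyclicComponent (Arc m′ (rev p)) →
    (m ≡ m′)
    × (Connected (Arc m p) → ∀ x → ¬ (InD m p x × InD m′ (rev p) x))
    × (Acyclic (Arc m p) → ¬ (∃ λ (x : Fin n) → DIsSingleton m p x × DIsSingleton m′ (rev p) x))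
lemma18 2≤n _ p m m′ μ-p μ-pʳ acyclic acyclicʳ with ℕ.≤-antisym m≤m′ m′≤m
  where
  m≤m′ : m ≤ m′
  m≤m′ = IsMuOf-minimal p μ-p (proj₁ μ-pʳ)
           (HasAcyclicComponent-converse (Arc-rev⁺ p) acyclicʳ)
  m′≤m : m′ ≤ m
  m′≤m = IsMuOf-minimal (rev p) μ-pʳ (proj₁ μ-p)
           (HasAcyclicComponent-converse (Arc-rev⁻ p) acyclic)
... | refl =
  refl , Connected⇒InD-disjoint p 2≤n ,
  Acyclic⇒¬InD-singletons p 2≤n (Admissible⇒1≤ (proj₁ μ-p))
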